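{- Let $\varphi = \forall \pi_1 \mathpunct{.} \forall \pi_2 \mathpunct{.} \psi$ be a HyperLTL formula, where $\psi$ is an LTL formula over the trace variables $\{\pi_1, \pi_2\}$. Then $\varphi$ is transitive if and only if \[ \varphi_\mathit{trans} = \exists \pi_1 \exists \pi_2 \exists \pi_3 \mathpunct{.} \big(\psi(\pi_1, \pi_2) \wedge \psi(\pi_2, \pi_3)\big) \nrightarrow \psi(\pi_1, \pi_3) \] is unsatisfiable.
   Context: Let $AP$ be a set of atomic propositions and $\Sigma = 2^{AP}$; traces are infinite words in $\Sigma^\omega$. A HyperLTL formula has the form $Q_1\pi_1\dots Q_n\pi_n\mathpunct{.}\psi$ with $Q_i\in\{\forall,\exists\}$, trace variables $\pi_i$, and $\psi$ an LTL formula whose atomic propositions are of the form $a_\pi$ ($a\in AP$), meaning $a$ holds at the current position of the trace assigned to $\pi$. For a set of traces $T$ and an assignment $\Pi$ of traces in $T$ to trace variables, $\Pi\models_T\psi$ is the usual LTL semantics evaluated synchronously on the assigned traces; quantifiers range over $T$. A HyperLTL formula is satisfiable if some nonempty set of traces satisfies it. $\psi(\pi_i,\pi_j)$ denotes $\psi$ with $\pi_1$ replaced by $\pi_i$ and $\pi_2$ by $\pi_j$; $A\nrightarrow B$ means $\neg(A\rightarrow B)$. The formula $\varphi$ is transitive if for every three-element set of traces $T=\{t_1,t_2,t_3\}\subseteq\Sigma^\omega$, writing $\Pi_{i,j}=\{\pi_1\mapsto t_i,\pi_2\mapsto t_j\}$, we have $(\Pi_{1,2}\models_T\psi)\wedge(\Pi_{2,3}\models_T\psi)\Rightarrow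 \Pi_{1,3}\models_T\psi$. -}

module Defs where

open import Data.Nat using (ℕ; zero; suc; _≤_; _<_; _+_)
open import Data.Fin using (Fin; zero; suc)
open import Data.Bool using (Bool; true)
open import Data.Product using (Σ; ∃; _×_; _,_)
open import Data.Sum using (_⊎_)
open import Data.Unit using (⊤)
open import Relation.Nullary using (¬_)
open import Relation.Binary.PropositionalEquality using (_≡_)

-- Letters of Σ = 2^AP are represented by characteristic functions AP → Bool;
-- traces are infinite words ℕ → Σ.
Letter : Set → Set
Letter AP = AP → Bool

Trace : Set → Set
Trace AP = ℕ → Letter AP

data LTL (AP : Set) (V : Set) : Set where
  tt   : LTL AP V
  atom : AP → V → LTL AP V
  ¬̇_   : LTL AP V → LTL AP V
  _∧̇_  : LTL AP V → LTL AP V → LTL AP V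
  Ẋ_   : LTL AP V → LTL AP V
  _U̇_  : LTL AP V → LTL AP V → LTL AP V

_∨̇_ : ∀ {AP V} → LTL AP V → LTL AP V → LTL AP V
φ ∨̇ ψ = ¬̇ ((¬̇ φ) ∧̇ (¬̇ ψ))

_⇒̇_ : ∀ {AP V} → LTL AP V → LTL AP V → LTL AP V
φ ⇒̇ ψ = (¬̇ φ) ∨̇ ψ

_↛̇_ : ∀ {AP V} → LTL AP V → LTL AP V → LTL AP V
φ ↛̇ ψ = ¬̇ (φ ⇒̇ ψ)

rename : ∀ {AP V W} → (V → W) → LTL AP V → LTL AP W
rename ρ tt = tt
rename ρ (atom a π) = atom a (ρ π)
rename ρ (¬̇ φ) = ¬̇ rename ρ φ
rename ρ (φ ∧̇ ψ) = rename ρ φ ∧̇ rename ρ ψ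
rename ρ (Ẋ φ) = Ẋ rename ρ φ
rename ρ (φ U̇ ψ) = rename ρ φ U̇ rename ρ ψ

-- Synchronous LTL semantics at position i under assignment Π.
-- (For a quantifier-free body the trace set T plays no role.)
_,_⊨_ : ∀ {AP V} → (V → Trace AP) → ℕ → LTL AP V → Set
Π , i ⊨ tt = ⊤
Π , i ⊨ atom a π = Π π i a ≡ true
Π , i ⊨ (¬̇ φ) = ¬ (Π , i ⊨ φ)
Π , i ⊨ (φ ∧̇ ψ) = (Π , i ⊨ φ) × (Π , i ⊨ ψ)
Π , i ⊨ (Ẋ φ) = Π , suc i ⊨ φ
Π , i ⊨ (φ U̇ ψ) =
  Σ ℕ λ k → (i ≤ k) × (Π , k ⊨ ψ) × (∀ j → i ≤ j → j < k → Π , j ⊨ φ)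

-- HyperLTL formulas with m trace variables already bound.
-- The variable bound by the (k+1)-th quantifier (counting from the outside) is Fin index k.
data HyperLTL (AP : Set) : ℕ → Set where
  ∀̇_   : ∀ {m} → HyperLTL AP (suc m) → HyperLTL AP m
  ∃̇_   : ∀ {m} → HyperLTL AP (suc m) → HyperLTL AP m
  body : ∀ {m} → LTL AP (Fin m) → HyperLTL AP m

-- extend an assignment of variables 0..m-1 by a value for variable m
extend : ∀ {A : Set} {m} → (Fin m → A) → A → Fin (suc m) → A
extend {m = zero}  Π t zero    = t
extend {m = suc m} Π t zero    = Π zero
extend {m = suc m} Π t (suc i) = extend (λ j → Π (suc j)) t i

sat : ∀ {AP m} → (Trace AP → Set) → (Fin m → Trace AP) → HyperLTL AP m → Set
sat T Π (∀̇ φ) = ∀ t → T t → sat T (extend Π t) φ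
sat T Π (∃̇ φ) = Σ (Trace _) λ t → T t × sat T (extend Π t) φ
sat T Π (body ψ) = Π , 0 ⊨ ψ

emptyAssign : ∀ {A : Set} → Fin 0 → A
emptyAssign ()

Satisfiable : ∀ {AP} → HyperLTL AP 0 → Set₁
Satisfiable {AP} φ =
  Σ (Trace AP → Set) λ T → (Σ (Trace AP) λ t → T t) × sat T emptyAssign φ

-- ψ(π_i, π_j): substitute π_1 ↦ π_i, π_2 ↦ π_j  (π_1 = Fin index 0, π_2 = index 1)
subst₂ : ∀ {AP n} → LTL AP (Fin 2) → Fin n → Fin n → LTL AP (Fin n)
subst₂ ψ i j = rename (λ { zero → i ; (suc zero) → j }) ψ

forall2 : ∀ {AP} → LTL AP (Fin 2) → HyperLTL AP 0
forall2 ψ = ∀̇ ∀̇ body ψ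

assign₂ : ∀ {AP} → Trace AP → Trace AP → Fin 2 → Trace AP
assign₂ t s zero = t
assign₂ t s (suc zero) = s

three : ∀ {AP} → Trace AP → Trace AP → Trace AP → Trace AP → Set
three t1 t2 t3 t = t ≡ t1 ⊎ t ≡ t2 ⊎ t ≡ t3

-- ∀π1∀π2.ψ is transitive: for every T = {t1,t2,t3},
-- Π_{1,2} ⊨_T ψ ∧ Π_{2,3} ⊨_T ψ ⇒ Π_{1,3} ⊨_T ψ.
-- (T is irrelevant for the quantifier-free body ψ; we evaluate via `sat` with T anyway.)
Transitive : ∀ {AP} → LTL AP (Fin 2) → Set
Transitive {AP} ψ = ∀ (t1 t2 t3 : Trace AP) →
  sat (three t1 t2 t3) (assign₂ t1 t2) (body ψ) →
  sat (three t1 t2 t3) (assign₂ t2 t3) (body ψ) →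
  sat (three t1 t2 t3) (assign₂ t1 t3) (body ψ)

φtrans : ∀ {AP} → LTL AP (Fin 2) → HyperLTL AP 0
φtrans ψ = ∃̇ ∃̇ ∃̇ body
  ((subst₂ ψ zero (suc zero) ∧̇ subst₂ ψ (suc zero) (suc (suc zero)))
     ↛̇ subst₂ ψ zero (suc (suc zero)))

-- A counterexample to transitivity is a triple (t₁, t₂, t₃) with ψ(t₁,t₂), ψ(t₂,t₃) and
-- ¬ψ(t₁,t₃); such a triple, as a trace set, satisfies φ_trans, and conversely the three
-- witnesses of φ_trans form one.  The only work is that ψ(πᵢ,πⱼ) evaluated under
-- {π₁,π₂,π₃ ↦ t₁,t₂,t₃} means ψ evaluated under {π₁,π₂ ↦ tᵢ,tⱼ}, i.e. that the semantics
-- commutes with renaming of trace variables.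
module Submission where

open import Defs
open import Level using (0ℓ)
open import Data.Fin using (Fin; zero; suc)
open import Data.Nat using (suc)
open import Data.Unit using (⊤; tt)
open import Data.Product using (_,_)
open import Relation.Nullary using (¬_)
open import Relation.Nullary.Decidable using (decidable-stable)
open import Relation.Binary.PropositionalEquality using (_≡_; refl; _≗_; subst; sym)
open import Function using (_∘_)
open import Function.Bundles using (_⇔_; mk⇔; Equivalence)
open import Axiom.ExcludedMiddle using (ExcludedMiddle)

open Equivalence using (to; from)

rename-⊨ : ∀ {AP V W} (ρ : V → W) {Π : W → Trace AP} {Π′ : V → Trace AP} →
  Π ∘ ρ ≗ Π′ → ∀ φ i → (Π , i ⊨ rename ρ φ) ⇔ (Π′ , i ⊨ φ)
rename-⊨ ρ Π∘ρ≗Π′ tt i = mk⇔ (λ x → x) (λ x → x)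
rename-⊨ ρ Π∘ρ≗Π′ (atom a π) i =
  mk⇔ (subst (λ t → t i a ≡ _) (Π∘ρ≗Π′ π)) (subst (λ t → t i a ≡ _) (sym (Π∘ρ≗Π′ π)))
rename-⊨ ρ Π∘ρ≗Π′ (¬̇ φ) i =
  mk⇔ (λ ¬x x → ¬x (from φ⇔ x)) (λ ¬x x → ¬x (to φ⇔ x))
  where φ⇔ = rename-⊨ ρ Π∘ρ≗Π′ φ i
rename-⊨ ρ Π∘ρ≗Π′ (φ ∧̇ ψ) i =
  mk⇔ (λ (x , y) → to φ⇔ x , to ψ⇔ y) (λ (x , y) → from φ⇔ x , from ψ⇔ y)
  where
  φ⇔ = rename-⊨ ρ Π∘ρ≗Π′ φ i
  ψ⇔ = rename-⊨ ρ Π∘ρ≗Π′ ψ i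
rename-⊨ ρ Π∘ρ≗Π′ (Ẋ φ) i = rename-⊨ ρ Π∘ρ≗Π′ φ (suc i)
rename-⊨ ρ Π∘ρ≗Π′ (φ U̇ ψ) i =
  mk⇔ (λ (k , i≤k , ψk , φ<k) → k , i≤k , to (ψ⇔ k) ψk , λ j i≤j j<k → to (φ⇔ j) (φ<k j i≤j j<k))
      (λ (k , i≤k , ψk , φ<k) → k , i≤k , from (ψ⇔ k) ψk , λ j i≤j j<k → from (φ⇔ j) (φ<k j i≤j j<k))
  where
  φ⇔ = rename-⊨ ρ Π∘ρ≗Π′ φ
  ψ⇔ = rename-⊨ ρ Π∘ρ≗Π′ ψ

subst₂-⊨ : ∀ {AP n} (ψ : LTL AP (Fin 2)) (Π : Fin n → Trace AP) (x y : Fin n) i →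
  (Π , i ⊨ subst₂ ψ x y) ⇔ (assign₂ (Π x) (Π y) , i ⊨ ψ)
subst₂-⊨ ψ Π x y = rename-⊨ _ (λ { zero → refl ; (suc zero) → refl }) ψ

-- φ ↛̇ ψ unfolds to ¬ ¬ (¬ ¬ φ × ¬ ψ).
⊨-↛-intro : ∀ {AP V} {Π : V → Trace AP} {i} {φ ψ : LTL AP V} →
  Π , i ⊨ φ → ¬ (Π , i ⊨ ψ) → Π , i ⊨ (φ ↛̇ ψ)
⊨-↛-intro φi ¬ψi ¬[¬¬φ∧¬ψ] = ¬[¬¬φ∧¬ψ] ((λ ¬φi → ¬φi φi) , ¬ψi)

⊨-↛-elim : ∀ {AP V} {Π : V → Trace AP} {i} {φ ψ : LTL AP V} →
  (Π , i ⊨ φ → Π , i ⊨ ψ) → ¬ (Π , i ⊨ (φ ↛̇ ψ))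
⊨-↛-elim φ⇒ψ ¬¬[¬¬φ∧¬ψ] = ¬¬[¬¬φ∧¬ψ] λ (¬¬φi , ¬ψi) → ¬¬φi (λ φi → ¬ψi (φ⇒ψ φi))

Holds : ∀ {AP} → LTL AP (Fin 2) → Trace AP → Trace AP → Set
Holds ψ t s = assign₂ t s , 0 ⊨ ψ

premises conclusion triangle : ∀ {AP} → LTL AP (Fin 2) → LTL AP (Fin 3)
premises ψ = subst₂ ψ zero (suc zero) ∧̇ subst₂ ψ (suc zero) (suc (suc zero))
conclusion ψ = subst₂ ψ zero (suc (suc zero))
triangle ψ = premises ψ ↛̇ conclusion ψ

assign₃ : ∀ {AP} → Trace AP → Trace AP → Trace AP → Fin 3 → Trace AP
assign₃ t₁ t₂ t₃ = extend (extend (extend emptyAssign t₁) t₂) t₃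

module _ {AP} (ψ : LTL AP (Fin 2)) (t₁ t₂ t₃ : Trace AP) where

  private
    Π = assign₃ t₁ t₂ t₃
    holds : ∀ x y → (Π , 0 ⊨ subst₂ ψ x y) ⇔ Holds ψ (Π x) (Π y)
    holds x y = subst₂-⊨ ψ Π x y 0

  triangle-violated : Holds ψ t₁ t₂ → Holds ψ t₂ t₃ → ¬ Holds ψ t₁ t₃ →
    Π , 0 ⊨ triangle ψ
  triangle-violated h₁₂ h₂₃ ¬h₁₃ =
    ⊨-↛-intro {φ = premises ψ} {ψ = conclusion ψ}
      (from (holds zero (suc zero)) h₁₂ , from (holds (suc zero) (suc (suc zero))) h₂₃)
      (¬h₁₃ ∘ to (holds zero (suc (suc zero))))

  triangle-closed : (Holds ψ t₁ t₂ → Holds ψ t₂ t₃ → Holds ψ t₁ t₃) →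
    ¬ (Π , 0 ⊨ triangle ψ)
  triangle-closed trans = ⊨-↛-elim {φ = premises ψ} {ψ = conclusion ψ} λ (h₁₂ , h₂₃) →
    from (holds zero (suc (suc zero)))
      (trans (to (holds zero (suc zero)) h₁₂) (to (holds (suc zero) (suc (suc zero))) h₂₃))

mainTheorem2 : ExcludedMiddle 0ℓ → (AP : Set) → (ψ : LTL AP (Fin 2)) →
    Transitive ψ ⇔ (¬ Satisfiable (φtrans ψ))
mainTheorem2 em AP ψ = mk⇔ transitive⇒unsat unsat⇒transitive
  where
  transitive⇒unsat : Transitive ψ → ¬ Satisfiable (φtrans ψ)
  transitive⇒unsat trans (_ , _ , t₁ , _ , t₂ , _ , t₃ , _ , violated) =
    triangle-closed ψ t₁ t₂ t₃ (trans t₁ t₂ t₃) violated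

  unsat⇒transitive : ¬ Satisfiable (φtrans ψ) → Transitive ψ
  -- Constructively φ_trans only refutes ¬ψ(t₁,t₃); excluded middle recovers ψ(t₁,t₃).
  unsat⇒transitive unsat t₁ t₂ t₃ h₁₂ h₂₃ = decidable-stable em λ ¬h₁₃ →
    unsat ( (λ _ → ⊤) , (t₁ , tt)
          , t₁ , tt , t₂ , tt , t₃ , tt , triangle-violated ψ t₁ t₂ t₃ h₁₂ h₂₃ ¬h₁₃)
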